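{- Let $\mathrm{Cont}=\mathtt{where}\{\mathtt{return}\,x=\lambda c.\,c!\,x;\ m\gg\!=f=\lambda c.\,m!\,\{\lambda y.\,f!\,y\,c\}\}$. Let $M\mapsto M^*$ be the translation from the untyped effect handler calculus to the untyped monadic reflection calculus that is homomorphic on all core constructs and satisfies $(\mathit{op}\,V)^*=\mathtt{reflect}(\lambda k.\lambda h.\,h!\,(\mathit{op}\,(V^*,\{\lambda y.\,k!\,y\,h\})))$ (using the operation name $\mathit{op}$ as a variant label) and, for $H=\{\mathtt{return}\,x\mapsto N_{\mathrm{ret}}\}\uplus\{\mathit{op}_i\,p_i\,k_i\mapsto N_i\}_{i=1}^n$, $(\mathtt{handle}\,M\,\mathtt{with}\,H)^*=(\mathtt{reify}_{\mathrm{Cont}}\,M^*)\,\{\lambda x.\lambda h.N_{\mathrm{ret}}^*\}\,\{\lambda y.\,\mathtt{case}\,y\,\mathtt{of}\,\{\mathit{op}_i\,(p_i,k_i)\mapsto N_i^*\}_{i=1}^n\}$ (with $h,k,y$ fresh and nested patterns desugared to $\mathtt{let}\,(p_i,k_i)=\cdot\,\mathtt{in}$). Then for all computations $M,N$ of the effect handler calculus, $M\to N$ implies $M^*\rightsquigarrow^{+}N^*$.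
   Context: Core syntax (shared). Values $V ::= x \mid () \mid (V_1,V_2) \mid \ell\,V \mid \{M\}$; computations $M,N ::= \mathtt{let}\,(x,y)=V\,\mathtt{in}\,M \mid \mathtt{case}\,V\,\mathtt{of}\,\{\ell_i x_i\mapsto M_i\}_i \mid V! \mid \mathtt{return}\,V \mid \mathtt{let}\,x\Leftarrow M\,\mathtt{in}\,N \mid \lambda x.M \mid M\,V \mid \langle M_1,M_2\rangle \mid \mathrm{prj}_i M$. Core $\beta$-rules: $\mathtt{let}\,(x,y)=(V_1,V_2)\,\mathtt{in}\,M \to_\beta M[V_1/x,V_2/y]$; $\mathtt{case}\,\ell_j V\,\mathtt{of}\,\{\dots\ell_j x_j\mapsto M_j\dots\}\to_\beta M_j[V/x_j]$; $\{M\}!\to_\beta M$; $\mathtt{let}\,x\Leftarrow\mathtt{return}\,V\,\mathtt{in}\,N\to_\beta N[V/x]$; $(\lambda x.M)V\to_\beta M[V/x]$; $\mathrm{prj}_i\langle M_1,M_2\rangle\to_\beta M_i$. Basic frames $B ::= \mathtt{let}\,x\Leftarrow[\,]\,\mathtt{in}\,N\mid[\,]\,V\mid\mathrm{prj}_i[\,]$; hoisting contexts $\mathcal{H}::=[\,]\mid\mathcal{H}[B]$. In each calculus $M\to N$ iff $M=K[M']$, $N=K[N']$ with $M'\to_\beta N'$ and $K$ an evaluation context of that calculus. Effect handler calculus: operation names $\mathit{op}$; adds computations $\mathit{op}\,V$ and $\mathtt{handle}\,M\,\mathtt{with}\,H$, where $H$ has a return clause $\mathtt{return}\,x\mapsto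 N_{\mathrm{ret}}$ and operation clauses $\mathit{op}\,p\,k\mapsto N_{\mathit{op}}$ for $\mathit{op}$ in a finite set $\mathrm{ops}(H)$; evaluation contexts $K::=[\,]\mid K[B]\mid K[\mathtt{handle}\,[\,]\,\mathtt{with}\,H]$; extra rules $\mathtt{handle}\,(\mathtt{return}\,V)\,\mathtt{with}\,H\to_\beta N_{\mathrm{ret}}[V/x]$ and $\mathtt{handle}\,\mathcal{H}[\mathit{op}\,V]\,\mathtt{with}\,H\to_\beta N_{\mathit{op}}[V/p,\{\lambda y.\mathtt{handle}\,\mathcal{H}[\mathtt{return}\,y]\,\mathtt{with}\,H\}/k]$ for $\mathit{op}\in\mathrm{ops}(H)$. Monadic reflection calculus: monad terms $T=\mathtt{where}\{\mathtt{return}\,x=N_u;\ y\gg\!=f=N_b\}$; adds computations $\mathtt{reflect}\,N$ and $\mathtt{reify}_T\,M$; evaluation contexts $K::=[\,]\mid K[B]\mid K[\mathtt{reify}_T[\,]]$; extra rules $\mathtt{reify}_T(\mathtt{return}\,V)\to_\beta N_u[V/x]$ and $\mathtt{reify}_T\,\mathcal{H}[\mathtt{reflect}\,N]\to_\beta N_b[\{N\}/y,\{\lambda z.\mathtt{reify}_T\,\mathcal{H}[\mathtt{return}\,z]\}/f]$. $\rightsquigarrow$ is the smallest relation on target terms containing $\to_\beta$ and closed under all term-forming constructs; $\rightsquigarrow^{+}$ is its transitive closure. -}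

module Defs where

-- Binder conventions (innermost = 0):
--   split V M      : let (x,y) = V in M     M in scope n+2, x = 1, y = 0
--   case V bs      : each branch  ℓ x ↦ M  M in scope n+1, x = 0
--   lett M N       : let x ⇐ M in N         N in scope n+1, x = 0
--   lam M          : λx.M                   M in scope n+1, x = 0
--   handler clauses: return x ↦ N           N in scope n+1, x = 0
--                    op p k ↦ N             N in scope n+2, p = 1, k = 0
--   monad term     : return x = Nu          Nu in scope n+1, x = 0
--                    y >>= f = Nb           Nb in scope n+2, y = 1, f = 0
-- Labels and operation names are natural numbers (the translation uses
-- an operation name as a variant label).

open import Data.Nat using (ℕ; zero; suc; _+_; _≡ᵇ_)
open import Data.Fin using (Fin; zero; suc)
open import Data.Maybe using (Maybe; just; nothing)
open import Data.Bool using (if_then_else_)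
open import Data.List using (List; []; _∷_)
open import Relation.Binary.PropositionalEquality using (_≡_)
open import Relation.Binary.Construct.Closure.Transitive using (TransClosure)

Label : Set
Label = ℕ

data Idx : Set where
  i₁ i₂ : Idx

Ren : ℕ → ℕ → Set
Ren n m = Fin n → Fin m

liftR : ∀ {n m} → Ren n m → Ren (suc n) (suc m)
liftR ρ zero    = zero
liftR ρ (suc i) = suc (ρ i)

module Eff where

  mutual
    data Val (n : ℕ) : Set where
      var   : Fin n → Val n
      unit  : Val n
      pair  : Val n → Val n → Val n
      inj   : Label → Val n → Val n
      thunk : Comp n → Val n

    data Comp (n : ℕ) : Set where
      split  : Val n → Comp (suc (suc n)) → Comp n
      case   : Val n → Branches n → Comp n
      force  : Val n → Comp n
      ret    : Val n → Comp n
      lett   : Comp n → Comp (suc n) → Comp n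
      lam    : Comp (suc n) → Comp n
      app    : Comp n → Val n → Comp n
      cpair  : Comp n → Comp n → Comp n
      prj    : Idx → Comp n → Comp n
      op     : Label → Val n → Comp n
      handle : Comp n → Handler n → Comp n

    data Branches (n : ℕ) : Set where
      []  : Branches n
      _∷_ : Label → Comp (suc n) → Branches n → Branches n

    data Handler (n : ℕ) : Set where
      handler : Comp (suc n) → OpClauses n → Handler n

    data OpClauses (n : ℕ) : Set where
      []    : OpClauses n
      claus : Label → Comp (suc (suc n)) → OpClauses n → OpClauses n

  mutual
    renV : ∀ {n m} → Ren n m → Val n → Val m
    renV ρ (var i)    = var (ρ i)
    renV ρ unit       = unit
    renV ρ (pair V W) = pair (renV ρ V) (renV ρ W)
    renV ρ (inj l V)  = inj l (renV ρ V)
    renV ρ (thunk M)  = thunk (renC ρ M)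

    renC : ∀ {n m} → Ren n m → Comp n → Comp m
    renC ρ (split V M)  = split (renV ρ V) (renC (liftR (liftR ρ)) M)
    renC ρ (case V bs)  = case (renV ρ V) (renB ρ bs)
    renC ρ (force V)    = force (renV ρ V)
    renC ρ (ret V)      = ret (renV ρ V)
    renC ρ (lett M N)   = lett (renC ρ M) (renC (liftR ρ) N)
    renC ρ (lam M)      = lam (renC (liftR ρ) M)
    renC ρ (app M V)    = app (renC ρ M) (renV ρ V)
    renC ρ (cpair M N)  = cpair (renC ρ M) (renC ρ N)
    renC ρ (prj i M)    = prj i (renC ρ M)
    renC ρ (op o V)     = op o (renV ρ V)
    renC ρ (handle M H) = handle (renC ρ M) (renH ρ H)

    renB : ∀ {n m} → Ren n m → Branches n → Branches m
    renB ρ []           = []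
    renB ρ (_∷_ l M bs) = _∷_ l (renC (liftR ρ) M) (renB ρ bs)

    renH : ∀ {n m} → Ren n m → Handler n → Handler m
    renH ρ (handler N cs) = handler (renC (liftR ρ) N) (renO ρ cs)

    renO : ∀ {n m} → Ren n m → OpClauses n → OpClauses m
    renO ρ []             = []
    renO ρ (claus o N cs) = claus o (renC (liftR (liftR ρ)) N) (renO ρ cs)

  Sub : ℕ → ℕ → Set
  Sub n m = Fin n → Val m

  exts : ∀ {n m} → Sub n m → Sub (suc n) (suc m)
  exts σ zero    = var zero
  exts σ (suc i) = renV suc (σ i)

  mutual
    subV : ∀ {n m} → Sub n m → Val n → Val m
    subV σ (var i)    = σ i
    subV σ unit       = unit
    subV σ (pair V W) = pair (subV σ V) (subV σ W)
    subV σ (inj l V)  = inj l (subV σ V)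
    subV σ (thunk M)  = thunk (subC σ M)

    subC : ∀ {n m} → Sub n m → Comp n → Comp m
    subC σ (split V M)  = split (subV σ V) (subC (exts (exts σ)) M)
    subC σ (case V bs)  = case (subV σ V) (subB σ bs)
    subC σ (force V)    = force (subV σ V)
    subC σ (ret V)      = ret (subV σ V)
    subC σ (lett M N)   = lett (subC σ M) (subC (exts σ) N)
    subC σ (lam M)      = lam (subC (exts σ) M)
    subC σ (app M V)    = app (subC σ M) (subV σ V)
    subC σ (cpair M N)  = cpair (subC σ M) (subC σ N)
    subC σ (prj i M)    = prj i (subC σ M)
    subC σ (op o V)     = op o (subV σ V)
    subC σ (handle M H) = handle (subC σ M) (subH σ H)

    subB : ∀ {n m} → Sub n m → Branches n → Branches m
    subB σ []           = []
    subB σ (_∷_ l M bs) = _∷_ l (subC (exts σ) M) (subB σ bs)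

    subH : ∀ {n m} → Sub n m → Handler n → Handler m
    subH σ (handler N cs) = handler (subC (exts σ) N) (subO σ cs)

    subO : ∀ {n m} → Sub n m → OpClauses n → OpClauses m
    subO σ []             = []
    subO σ (claus o N cs) = claus o (subC (exts (exts σ)) N) (subO σ cs)

  sub1 : ∀ {n} → Val n → Sub (suc n) n
  sub1 V zero    = V
  sub1 V (suc i) = var i

  -- M[V₁/x, V₂/y]  (x = variable 1, y = variable 0)
  sub2 : ∀ {n} → Val n → Val n → Sub (suc (suc n)) n
  sub2 V₁ V₂ zero          = V₂
  sub2 V₁ V₂ (suc zero)    = V₁
  sub2 V₁ V₂ (suc (suc i)) = var i

  _[_]₁ : ∀ {n} → Comp (suc n) → Val n → Comp n
  M [ V ]₁ = subC (sub1 V) M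

  _[_,_]₂ : ∀ {n} → Comp (suc (suc n)) → Val n → Val n → Comp n
  M [ V₁ , V₂ ]₂ = subC (sub2 V₁ V₂) M

  lookupB : ∀ {n} → Branches n → Label → Maybe (Comp (suc n))
  lookupB []           l = nothing
  lookupB (_∷_ l' M bs) l = if l ≡ᵇ l' then just M else lookupB bs l

  lookupO : ∀ {n} → OpClauses n → Label → Maybe (Comp (suc (suc n)))
  lookupO []             o = nothing
  lookupO (claus o' N cs) o = if o ≡ᵇ o' then just N else lookupO cs o

  data BFrame (n : ℕ) : Set where
    letF : Comp (suc n) → BFrame n
    appF : Val n → BFrame n
    prjF : Idx → BFrame n

  plugB : ∀ {n} → BFrame n → Comp n → Comp n
  plugB (letF N) M = lett M N
  plugB (appF V) M = app M V
  plugB (prjF i) M = prj i M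

  renBF : ∀ {n m} → Ren n m → BFrame n → BFrame m
  renBF ρ (letF N) = letF (renC (liftR ρ) N)
  renBF ρ (appF V) = appF (renV ρ V)
  renBF ρ (prjF i) = prjF i

  -- hoisting contexts: finite sequences of basic frames (head = outermost)
  Hoist : ℕ → Set
  Hoist n = List (BFrame n)

  plugH : ∀ {n} → Hoist n → Comp n → Comp n
  plugH []      M = M
  plugH (B ∷ 𝓗) M = plugB B (plugH 𝓗 M)

  renHo : ∀ {n m} → Ren n m → Hoist n → Hoist m
  renHo ρ []      = []
  renHo ρ (B ∷ 𝓗) = renBF ρ B ∷ renHo ρ 𝓗

  data EFrame (n : ℕ) : Set where
    basic   : BFrame n → EFrame n
    handleF : Handler n → EFrame n

  plugE : ∀ {n} → EFrame n → Comp n → Comp n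
  plugE (basic B)   M = plugB B M
  plugE (handleF H) M = handle M H

  ECtx : ℕ → Set
  ECtx n = List (EFrame n)

  plug : ∀ {n} → ECtx n → Comp n → Comp n
  plug []      M = M
  plug (F ∷ K) M = plugE F (plug K M)

  pick : ∀ {A : Set} → Idx → A → A → A
  pick i₁ a b = a
  pick i₂ a b = b

  retClause : ∀ {n} → Handler n → Comp (suc n)
  retClause (handler N cs) = N

  opClauses : ∀ {n} → Handler n → OpClauses n
  opClauses (handler N cs) = cs

  data _⟶β_ {n : ℕ} : Comp n → Comp n → Set where
    split-β  : ∀ V₁ V₂ M → split (pair V₁ V₂) M ⟶β (M [ V₁ , V₂ ]₂)
    case-β   : ∀ l V bs M → lookupB bs l ≡ just M → case (inj l V) bs ⟶β (M [ V ]₁)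
    force-β  : ∀ M → force (thunk M) ⟶β M
    let-β    : ∀ V N → lett (ret V) N ⟶β (N [ V ]₁)
    lam-β    : ∀ M V → app (lam M) V ⟶β (M [ V ]₁)
    prj-β    : ∀ i M₁ M₂ → prj i (cpair M₁ M₂) ⟶β pick i M₁ M₂
    ret-β    : ∀ V H → handle (ret V) H ⟶β (retClause H [ V ]₁)
    op-β     : ∀ (𝓗 : Hoist n) o V H N → lookupO (opClauses H) o ≡ just N →
               handle (plugH 𝓗 (op o V)) H ⟶β
                 (N [ V , thunk (lam (handle (plugH (renHo suc 𝓗) (ret (var zero)))
                                              (renH suc H))) ]₂)

  data _⟶_ {n : ℕ} : Comp n → Comp n → Set where
    ctx : ∀ (K : ECtx n) {M N} → M ⟶β N → plug K M ⟶ plug K N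

module Ref where

  mutual
    data Val (n : ℕ) : Set where
      var   : Fin n → Val n
      unit  : Val n
      pair  : Val n → Val n → Val n
      inj   : Label → Val n → Val n
      thunk : Comp n → Val n

    data Comp (n : ℕ) : Set where
      split   : Val n → Comp (suc (suc n)) → Comp n
      case    : Val n → Branches n → Comp n
      force   : Val n → Comp n
      ret     : Val n → Comp n
      lett    : Comp n → Comp (suc n) → Comp n
      lam     : Comp (suc n) → Comp n
      app     : Comp n → Val n → Comp n
      cpair   : Comp n → Comp n → Comp n
      prj     : Idx → Comp n → Comp n
      reflect : Comp n → Comp n
      reify   : Monad n → Comp n → Comp n

    data Branches (n : ℕ) : Set where
      []  : Branches n
      _∷_ : Label → Comp (suc n) → Branches n → Branches n

    data Monad (n : ℕ) : Set where
      where' : Comp (suc n) → Comp (suc (suc n)) → Monad n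

  mutual
    renV : ∀ {n m} → Ren n m → Val n → Val m
    renV ρ (var i)    = var (ρ i)
    renV ρ unit       = unit
    renV ρ (pair V W) = pair (renV ρ V) (renV ρ W)
    renV ρ (inj l V)  = inj l (renV ρ V)
    renV ρ (thunk M)  = thunk (renC ρ M)

    renC : ∀ {n m} → Ren n m → Comp n → Comp m
    renC ρ (split V M)  = split (renV ρ V) (renC (liftR (liftR ρ)) M)
    renC ρ (case V bs)  = case (renV ρ V) (renB ρ bs)
    renC ρ (force V)    = force (renV ρ V)
    renC ρ (ret V)      = ret (renV ρ V)
    renC ρ (lett M N)   = lett (renC ρ M) (renC (liftR ρ) N)
    renC ρ (lam M)      = lam (renC (liftR ρ) M)
    renC ρ (app M V)    = app (renC ρ M) (renV ρ V)
    renC ρ (cpair M N)  = cpair (renC ρ M) (renC ρ N)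
    renC ρ (prj i M)    = prj i (renC ρ M)
    renC ρ (reflect M)  = reflect (renC ρ M)
    renC ρ (reify T M)  = reify (renM ρ T) (renC ρ M)

    renB : ∀ {n m} → Ren n m → Branches n → Branches m
    renB ρ []           = []
    renB ρ (_∷_ l M bs) = _∷_ l (renC (liftR ρ) M) (renB ρ bs)

    renM : ∀ {n m} → Ren n m → Monad n → Monad m
    renM ρ (where' Nu Nb) = where' (renC (liftR ρ) Nu) (renC (liftR (liftR ρ)) Nb)

  Sub : ℕ → ℕ → Set
  Sub n m = Fin n → Val m

  exts : ∀ {n m} → Sub n m → Sub (suc n) (suc m)
  exts σ zero    = var zero
  exts σ (suc i) = renV suc (σ i)

  mutual
    subV : ∀ {n m} → Sub n m → Val n → Val m
    subV σ (var i)    = σ i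
    subV σ unit       = unit
    subV σ (pair V W) = pair (subV σ V) (subV σ W)
    subV σ (inj l V)  = inj l (subV σ V)
    subV σ (thunk M)  = thunk (subC σ M)

    subC : ∀ {n m} → Sub n m → Comp n → Comp m
    subC σ (split V M)  = split (subV σ V) (subC (exts (exts σ)) M)
    subC σ (case V bs)  = case (subV σ V) (subB σ bs)
    subC σ (force V)    = force (subV σ V)
    subC σ (ret V)      = ret (subV σ V)
    subC σ (lett M N)   = lett (subC σ M) (subC (exts σ) N)
    subC σ (lam M)      = lam (subC (exts σ) M)
    subC σ (app M V)    = app (subC σ M) (subV σ V)
    subC σ (cpair M N)  = cpair (subC σ M) (subC σ N)
    subC σ (prj i M)    = prj i (subC σ M)
    subC σ (reflect M)  = reflect (subC σ M)
    subC σ (reify T M)  = reify (subM σ T) (subC σ M)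

    subB : ∀ {n m} → Sub n m → Branches n → Branches m
    subB σ []           = []
    subB σ (_∷_ l M bs) = _∷_ l (subC (exts σ) M) (subB σ bs)

    subM : ∀ {n m} → Sub n m → Monad n → Monad m
    subM σ (where' Nu Nb) = where' (subC (exts σ) Nu) (subC (exts (exts σ)) Nb)

  sub1 : ∀ {n} → Val n → Sub (suc n) n
  sub1 V zero    = V
  sub1 V (suc i) = var i

  sub2 : ∀ {n} → Val n → Val n → Sub (suc (suc n)) n
  sub2 V₁ V₂ zero          = V₂
  sub2 V₁ V₂ (suc zero)    = V₁
  sub2 V₁ V₂ (suc (suc i)) = var i

  _[_]₁ : ∀ {n} → Comp (suc n) → Val n → Comp n
  M [ V ]₁ = subC (sub1 V) M

  _[_,_]₂ : ∀ {n} → Comp (suc (suc n)) → Val n → Val n → Comp n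
  M [ V₁ , V₂ ]₂ = subC (sub2 V₁ V₂) M

  lookupB : ∀ {n} → Branches n → Label → Maybe (Comp (suc n))
  lookupB []            l = nothing
  lookupB (_∷_ l' M bs) l = if l ≡ᵇ l' then just M else lookupB bs l

  data BFrame (n : ℕ) : Set where
    letF : Comp (suc n) → BFrame n
    appF : Val n → BFrame n
    prjF : Idx → BFrame n

  plugB : ∀ {n} → BFrame n → Comp n → Comp n
  plugB (letF N) M = lett M N
  plugB (appF V) M = app M V
  plugB (prjF i) M = prj i M

  renBF : ∀ {n m} → Ren n m → BFrame n → BFrame m
  renBF ρ (letF N) = letF (renC (liftR ρ) N)
  renBF ρ (appF V) = appF (renV ρ V)
  renBF ρ (prjF i) = prjF i

  Hoist : ℕ → Set
  Hoist n = List (BFrame n)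

  plugH : ∀ {n} → Hoist n → Comp n → Comp n
  plugH []      M = M
  plugH (B ∷ 𝓗) M = plugB B (plugH 𝓗 M)

  renHo : ∀ {n m} → Ren n m → Hoist n → Hoist m
  renHo ρ []      = []
  renHo ρ (B ∷ 𝓗) = renBF ρ B ∷ renHo ρ 𝓗

  pick : ∀ {A : Set} → Idx → A → A → A
  pick i₁ a b = a
  pick i₂ a b = b

  unitClause : ∀ {n} → Monad n → Comp (suc n)
  unitClause (where' Nu Nb) = Nu

  bindClause : ∀ {n} → Monad n → Comp (suc (suc n))
  bindClause (where' Nu Nb) = Nb

  data _⟶β_ {n : ℕ} : Comp n → Comp n → Set where
    split-β   : ∀ V₁ V₂ M → split (pair V₁ V₂) M ⟶β (M [ V₁ , V₂ ]₂)
    case-β    : ∀ l V bs M → lookupB bs l ≡ just M → case (inj l V) bs ⟶β (M [ V ]₁)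
    force-β   : ∀ M → force (thunk M) ⟶β M
    let-β     : ∀ V N → lett (ret V) N ⟶β (N [ V ]₁)
    lam-β     : ∀ M V → app (lam M) V ⟶β (M [ V ]₁)
    prj-β     : ∀ i M₁ M₂ → prj i (cpair M₁ M₂) ⟶β pick i M₁ M₂
    reify-ret : ∀ T V → reify T (ret V) ⟶β (unitClause T [ V ]₁)
    reify-ref : ∀ T (𝓗 : Hoist n) N →
                reify T (plugH 𝓗 (reflect N)) ⟶β
                  (bindClause T [ thunk N
                                , thunk (lam (reify (renM suc T)
                                                    (plugH (renHo suc 𝓗) (ret (var zero))))) ]₂)

  mutual
    data _⇝_ {n : ℕ} : Comp n → Comp n → Set where
      β        : ∀ {M N} → M ⟶β N → M ⇝ N
      split₁   : ∀ {V V' M} → V ⇝ᵛ V' → split V M ⇝ split V' M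
      split₂   : ∀ {V M M'} → M ⇝ M' → split V M ⇝ split V M'
      case₁    : ∀ {V V' bs} → V ⇝ᵛ V' → case V bs ⇝ case V' bs
      case₂    : ∀ {V bs bs'} → bs ⇝ᵇ bs' → case V bs ⇝ case V bs'
      force₁   : ∀ {V V'} → V ⇝ᵛ V' → force V ⇝ force V'
      ret₁     : ∀ {V V'} → V ⇝ᵛ V' → ret V ⇝ ret V'
      lett₁    : ∀ {M M' N} → M ⇝ M' → lett M N ⇝ lett M' N
      lett₂    : ∀ {M N N'} → N ⇝ N' → lett M N ⇝ lett M N'
      lam₁     : ∀ {M M'} → M ⇝ M' → lam M ⇝ lam M'
      app₁     : ∀ {M M' V} → M ⇝ M' → app M V ⇝ app M' V
      app₂     : ∀ {M V V'} → V ⇝ᵛ V' → app M V ⇝ app M V'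
      cpair₁   : ∀ {M M' N} → M ⇝ M' → cpair M N ⇝ cpair M' N
      cpair₂   : ∀ {M N N'} → N ⇝ N' → cpair M N ⇝ cpair M N'
      prj₁     : ∀ {i M M'} → M ⇝ M' → prj i M ⇝ prj i M'
      reflect₁ : ∀ {M M'} → M ⇝ M' → reflect M ⇝ reflect M'
      reify₁   : ∀ {T T' M} → T ⇝ᵐ T' → reify T M ⇝ reify T' M
      reify₂   : ∀ {T M M'} → M ⇝ M' → reify T M ⇝ reify T M'

    data _⇝ᵛ_ {n : ℕ} : Val n → Val n → Set where
      pair₁  : ∀ {V V' W} → V ⇝ᵛ V' → pair V W ⇝ᵛ pair V' W
      pair₂  : ∀ {V W W'} → W ⇝ᵛ W' → pair V W ⇝ᵛ pair V W'
      inj₁   : ∀ {l V V'} → V ⇝ᵛ V' → inj l V ⇝ᵛ inj l V'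
      thunk₁ : ∀ {M M'} → M ⇝ M' → thunk M ⇝ᵛ thunk M'

    data _⇝ᵇ_ {n : ℕ} : Branches n → Branches n → Set where
      here  : ∀ {l M M' bs} → M ⇝ M' → _∷_ l M bs ⇝ᵇ _∷_ l M' bs
      there : ∀ {l M bs bs'} → bs ⇝ᵇ bs' → _∷_ l M bs ⇝ᵇ _∷_ l M bs'

    data _⇝ᵐ_ {n : ℕ} : Monad n → Monad n → Set where
      unit₁ : ∀ {Nu Nu' Nb} → Nu ⇝ Nu' → where' Nu Nb ⇝ᵐ where' Nu' Nb
      bind₁ : ∀ {Nu Nb Nb'} → Nb ⇝ Nb' → where' Nu Nb ⇝ᵐ where' Nu Nb'

  _⇝⁺_ : ∀ {n} → Comp n → Comp n → Set
  _⇝⁺_ = TransClosure _⇝_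

  -- Cont = where { return x = λc. c! x ; m >>= f = λc. m! {λy. f! y c} }
  Cont : ∀ {n} → Monad n
  Cont = where'
    -- scope x(1), c(0)
    (lam (app (force (var zero)) (var (suc zero))))
    -- scope m(2), f(1), c(0); under λy: m(3), f(2), c(1), y(0)
    (lam (app (force (var (suc (suc zero))))
              (thunk (lam (app (app (force (var (suc (suc zero)))) (var zero))
                               (var (suc zero)))))))

wk2 : ∀ {n} → Ren n (suc (suc n))
wk2 i = suc (suc i)

mutual
  transV : ∀ {n} → Eff.Val n → Ref.Val n
  transV (Eff.var i)    = Ref.var i
  transV Eff.unit       = Ref.unit
  transV (Eff.pair V W) = Ref.pair (transV V) (transV W)
  transV (Eff.inj l V)  = Ref.inj l (transV V)
  transV (Eff.thunk M)  = Ref.thunk (transC M)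

  transC : ∀ {n} → Eff.Comp n → Ref.Comp n
  transC (Eff.split V M) = Ref.split (transV V) (transC M)
  transC (Eff.case V bs) = Ref.case (transV V) (transB bs)
  transC (Eff.force V)   = Ref.force (transV V)
  transC (Eff.ret V)     = Ref.ret (transV V)
  transC (Eff.lett M N)  = Ref.lett (transC M) (transC N)
  transC (Eff.lam M)     = Ref.lam (transC M)
  transC (Eff.app M V)   = Ref.app (transC M) (transV V)
  transC (Eff.cpair M N) = Ref.cpair (transC M) (transC N)
  transC (Eff.prj i M)   = Ref.prj i (transC M)
  -- (op V)* = reflect (λk.λh. h! (op (V*, {λy. k! y h})))
  --   under λk.λh : k(1), h(0); under λy : k(2), h(1), y(0)
  transC (Eff.op o V) =
    Ref.reflect (Ref.lam (Ref.lam
      (Ref.app (Ref.force (Ref.var zero))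
               (Ref.inj o (Ref.pair (Ref.renV wk2 (transV V))
                                    (Ref.thunk (Ref.lam
                                      (Ref.app (Ref.app (Ref.force (Ref.var (suc (suc zero))))
                                                        (Ref.var zero))
                                               (Ref.var (suc zero))))))))))
  -- N_ret : scope x(0); under λx.λh : x(1), h(0), so N_ret* is weakened by suc
  -- (handle M with H)* =
  --   (reify_Cont M*) {λx.λh. N_ret*} {λy. case y of {op_i z ↦ let (p_i,k_i) = z in N_i*}}
  transC (Eff.handle M (Eff.handler Nret cs)) =
    Ref.app (Ref.app (Ref.reify Ref.Cont (transC M))
                     (Ref.thunk (Ref.lam (Ref.lam (Ref.renC suc (transC Nret))))))
            (Ref.thunk (Ref.lam (Ref.case (Ref.var zero) (transO cs))))

  transB : ∀ {n} → Eff.Branches n → Ref.Branches n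
  transB Eff.[]             = Ref.[]
  transB (Eff._∷_ l M bs)   = Ref._∷_ l (transC M) (transB bs)

  -- operation clauses become case branches, in the scope under λy;
  -- each branch binds z, then let (p,k) = z binds p(1), k(0):
  -- scope ... y(3), z(2), p(1), k(0)
  transO : ∀ {n} → Eff.OpClauses n → Ref.Branches (suc n)
  transO Eff.[]               = Ref.[]
  transO (Eff.claus o N cs)   =
    Ref._∷_ o (Ref.split (Ref.var zero) (Ref.renC (liftR (liftR wk2)) (transC N)))
              (transO cs)

module Submission where

-- The translation of a handler runs the handled computation in the continuation
-- monad and applies the result to two continuations, {λx.λh.N_ret*} and the case
-- distinction over the operation clauses.  A return is passed to the first.  An
-- operation reflects λk.λh. h! (op (V*, {λy. k! y h})); Cont binds k to the reified
-- remainder of the hoisting context, so the operation arrives at the second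
-- continuation as op (V*, {λy. k! y h}), and k! y h unfolds to the translation of
-- the handled resumption.  All other β-rules are simulated by the same rule, and
-- evaluation contexts translate into contexts of the compatible closure.

open import Data.Nat using (ℕ; zero; suc; _≡ᵇ_)
open import Data.Fin using (zero; suc)
open import Data.Bool using (Bool; true; false)
open import Data.Maybe using (just)
import Data.Maybe as Maybe
open import Data.List using ([]; _∷_)
open import Relation.Binary.PropositionalEquality
open import Relation.Binary.Construct.Closure.Transitive using ([_]; _∷_; _++_)
open import Defs

module E = Eff
module R = Ref

module RefSubstitution where
  open Ref

  private
    variable
      n m k : ℕ
      ρ ρ' ρ'' ρ₁ ρ₂ ρ₃ ρ₄ : Ren n m
      σ σ' τ : Sub n m

  liftR-comp : (∀ i → ρ' (ρ i) ≡ ρ'' i) → ∀ i → liftR ρ' (liftR ρ i) ≡ liftR ρ'' i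
  liftR-comp h zero    = refl
  liftR-comp h (suc i) = cong suc (h i)

  mutual
    renV-renV : (∀ i → ρ' (ρ i) ≡ ρ'' i) → ∀ V → renV ρ' (renV ρ V) ≡ renV ρ'' V
    renV-renV h (var i)    = cong var (h i)
    renV-renV h unit       = refl
    renV-renV h (pair V W) = cong₂ pair (renV-renV h V) (renV-renV h W)
    renV-renV h (inj l V)  = cong (inj l) (renV-renV h V)
    renV-renV h (thunk M)  = cong thunk (renC-renC h M)

    renC-renC : (∀ i → ρ' (ρ i) ≡ ρ'' i) → ∀ M → renC ρ' (renC ρ M) ≡ renC ρ'' M
    renC-renC h (split V M)  = cong₂ split (renV-renV h V) (renC-renC (liftR-comp (liftR-comp h)) M)
    renC-renC h (case V bs)  = cong₂ case (renV-renV h V) (renB-renB h bs)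
    renC-renC h (force V)    = cong force (renV-renV h V)
    renC-renC h (ret V)      = cong ret (renV-renV h V)
    renC-renC h (lett M N)   = cong₂ lett (renC-renC h M) (renC-renC (liftR-comp h) N)
    renC-renC h (lam M)      = cong lam (renC-renC (liftR-comp h) M)
    renC-renC h (app M V)    = cong₂ app (renC-renC h M) (renV-renV h V)
    renC-renC h (cpair M N)  = cong₂ cpair (renC-renC h M) (renC-renC h N)
    renC-renC h (prj i M)    = cong (prj i) (renC-renC h M)
    renC-renC h (reflect M)  = cong reflect (renC-renC h M)
    renC-renC h (reify T M)  = cong₂ reify (renM-renM h T) (renC-renC h M)

    renB-renB : (∀ i → ρ' (ρ i) ≡ ρ'' i) → ∀ bs → renB ρ' (renB ρ bs) ≡ renB ρ'' bs
    renB-renB h []         = refl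
    renB-renB h (_∷_ l M bs) = cong₂ (_∷_ l) (renC-renC (liftR-comp h) M) (renB-renB h bs)

    renM-renM : (∀ i → ρ' (ρ i) ≡ ρ'' i) → ∀ T → renM ρ' (renM ρ T) ≡ renM ρ'' T
    renM-renM h (where' Nu Nb) =
      cong₂ where' (renC-renC (liftR-comp h) Nu) (renC-renC (liftR-comp (liftR-comp h)) Nb)

  renV-renV-comm : (∀ i → ρ₂ (ρ₁ i) ≡ ρ₄ (ρ₃ i)) →
                   ∀ V → renV ρ₂ (renV ρ₁ V) ≡ renV ρ₄ (renV ρ₃ V)
  renV-renV-comm h V = trans (renV-renV h V) (sym (renV-renV (λ _ → refl) V))

  renC-renC-comm : (∀ i → ρ₂ (ρ₁ i) ≡ ρ₄ (ρ₃ i)) →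
                   ∀ M → renC ρ₂ (renC ρ₁ M) ≡ renC ρ₄ (renC ρ₃ M)
  renC-renC-comm h M = trans (renC-renC h M) (sym (renC-renC (λ _ → refl) M))

  exts-renV : (∀ i → renV ρ (σ i) ≡ τ i) → ∀ i → renV (liftR ρ) (exts σ i) ≡ exts τ i
  exts-renV h zero    = refl
  exts-renV {σ = σ} h (suc i) = trans (renV-renV-comm (λ _ → refl) (σ i)) (cong (renV suc) (h i))

  mutual
    renV-subV : (∀ i → renV ρ (σ i) ≡ τ i) → ∀ V → renV ρ (subV σ V) ≡ subV τ V
    renV-subV h (var i)    = h i
    renV-subV h unit       = refl
    renV-subV h (pair V W) = cong₂ pair (renV-subV h V) (renV-subV h W)
    renV-subV h (inj l V)  = cong (inj l) (renV-subV h V)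
    renV-subV h (thunk M)  = cong thunk (renC-subC h M)

    renC-subC : (∀ i → renV ρ (σ i) ≡ τ i) → ∀ M → renC ρ (subC σ M) ≡ subC τ M
    renC-subC h (split V M)  = cong₂ split (renV-subV h V) (renC-subC (exts-renV (exts-renV h)) M)
    renC-subC h (case V bs)  = cong₂ case (renV-subV h V) (renB-subB h bs)
    renC-subC h (force V)    = cong force (renV-subV h V)
    renC-subC h (ret V)      = cong ret (renV-subV h V)
    renC-subC h (lett M N)   = cong₂ lett (renC-subC h M) (renC-subC (exts-renV h) N)
    renC-subC h (lam M)      = cong lam (renC-subC (exts-renV h) M)
    renC-subC h (app M V)    = cong₂ app (renC-subC h M) (renV-subV h V)
    renC-subC h (cpair M N)  = cong₂ cpair (renC-subC h M) (renC-subC h N)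
    renC-subC h (prj i M)    = cong (prj i) (renC-subC h M)
    renC-subC h (reflect M)  = cong reflect (renC-subC h M)
    renC-subC h (reify T M)  = cong₂ reify (renM-subM h T) (renC-subC h M)

    renB-subB : (∀ i → renV ρ (σ i) ≡ τ i) → ∀ bs → renB ρ (subB σ bs) ≡ subB τ bs
    renB-subB h []         = refl
    renB-subB h (_∷_ l M bs) = cong₂ (_∷_ l) (renC-subC (exts-renV h) M) (renB-subB h bs)

    renM-subM : (∀ i → renV ρ (σ i) ≡ τ i) → ∀ T → renM ρ (subM σ T) ≡ subM τ T
    renM-subM h (where' Nu Nb) =
      cong₂ where' (renC-subC (exts-renV h) Nu) (renC-subC (exts-renV (exts-renV h)) Nb)

  exts-liftR : (∀ i → σ (ρ i) ≡ τ i) → ∀ i → exts σ (liftR ρ i) ≡ exts τ i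
  exts-liftR h zero    = refl
  exts-liftR h (suc i) = cong (renV suc) (h i)

  mutual
    subV-renV : (∀ i → σ (ρ i) ≡ τ i) → ∀ V → subV σ (renV ρ V) ≡ subV τ V
    subV-renV h (var i)    = h i
    subV-renV h unit       = refl
    subV-renV h (pair V W) = cong₂ pair (subV-renV h V) (subV-renV h W)
    subV-renV h (inj l V)  = cong (inj l) (subV-renV h V)
    subV-renV h (thunk M)  = cong thunk (subC-renC h M)

    subC-renC : (∀ i → σ (ρ i) ≡ τ i) → ∀ M → subC σ (renC ρ M) ≡ subC τ M
    subC-renC h (split V M)  = cong₂ split (subV-renV h V) (subC-renC (exts-liftR (exts-liftR h)) M)
    subC-renC h (case V bs)  = cong₂ case (subV-renV h V) (subB-renB h bs)
    subC-renC h (force V)    = cong force (subV-renV h V)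
    subC-renC h (ret V)      = cong ret (subV-renV h V)
    subC-renC h (lett M N)   = cong₂ lett (subC-renC h M) (subC-renC (exts-liftR h) N)
    subC-renC h (lam M)      = cong lam (subC-renC (exts-liftR h) M)
    subC-renC h (app M V)    = cong₂ app (subC-renC h M) (subV-renV h V)
    subC-renC h (cpair M N)  = cong₂ cpair (subC-renC h M) (subC-renC h N)
    subC-renC h (prj i M)    = cong (prj i) (subC-renC h M)
    subC-renC h (reflect M)  = cong reflect (subC-renC h M)
    subC-renC h (reify T M)  = cong₂ reify (subM-renM h T) (subC-renC h M)

    subB-renB : (∀ i → σ (ρ i) ≡ τ i) → ∀ bs → subB σ (renB ρ bs) ≡ subB τ bs
    subB-renB h []         = refl
    subB-renB h (_∷_ l M bs) = cong₂ (_∷_ l) (subC-renC (exts-liftR h) M) (subB-renB h bs)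

    subM-renM : (∀ i → σ (ρ i) ≡ τ i) → ∀ T → subM σ (renM ρ T) ≡ subM τ T
    subM-renM h (where' Nu Nb) =
      cong₂ where' (subC-renC (exts-liftR h) Nu) (subC-renC (exts-liftR (exts-liftR h)) Nb)

  renV-subV-comm : (∀ i → renV ρ' (σ i) ≡ σ' (ρ i)) →
                   ∀ V → renV ρ' (subV σ V) ≡ subV σ' (renV ρ V)
  renV-subV-comm h V = trans (renV-subV h V) (sym (subV-renV (λ _ → refl) V))

  renC-subC-comm : (∀ i → renV ρ' (σ i) ≡ σ' (ρ i)) →
                   ∀ M → renC ρ' (subC σ M) ≡ subC σ' (renC ρ M)
  renC-subC-comm h M = trans (renC-subC h M) (sym (subC-renC (λ _ → refl) M))

  exts-comm : (∀ i → renV ρ' (σ i) ≡ σ' (ρ i)) →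
              ∀ i → renV (liftR ρ') (exts σ i) ≡ exts σ' (liftR ρ i)
  exts-comm h zero    = refl
  exts-comm {σ = σ} h (suc i) = trans (renV-renV-comm (λ _ → refl) (σ i)) (cong (renV suc) (h i))

  wk2-exts² : (τ : Sub n m) → ∀ i → renV wk2 (τ i) ≡ exts (exts τ) (wk2 i)
  wk2-exts² τ i = sym (renV-renV (λ _ → refl) (τ i))

  exts-subV : (∀ i → subV σ' (σ i) ≡ τ i) → ∀ i → subV (exts σ') (exts σ i) ≡ exts τ i
  exts-subV h zero    = refl
  exts-subV {σ = σ} h (suc i) = trans (sym (renV-subV-comm (λ _ → refl) (σ i))) (cong (renV suc) (h i))

  mutual
    subV-subV : (∀ i → subV σ' (σ i) ≡ τ i) → ∀ V → subV σ' (subV σ V) ≡ subV τ V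
    subV-subV h (var i)    = h i
    subV-subV h unit       = refl
    subV-subV h (pair V W) = cong₂ pair (subV-subV h V) (subV-subV h W)
    subV-subV h (inj l V)  = cong (inj l) (subV-subV h V)
    subV-subV h (thunk M)  = cong thunk (subC-subC h M)

    subC-subC : (∀ i → subV σ' (σ i) ≡ τ i) → ∀ M → subC σ' (subC σ M) ≡ subC τ M
    subC-subC h (split V M)  = cong₂ split (subV-subV h V) (subC-subC (exts-subV (exts-subV h)) M)
    subC-subC h (case V bs)  = cong₂ case (subV-subV h V) (subB-subB h bs)
    subC-subC h (force V)    = cong force (subV-subV h V)
    subC-subC h (ret V)      = cong ret (subV-subV h V)
    subC-subC h (lett M N)   = cong₂ lett (subC-subC h M) (subC-subC (exts-subV h) N)
    subC-subC h (lam M)      = cong lam (subC-subC (exts-subV h) M)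
    subC-subC h (app M V)    = cong₂ app (subC-subC h M) (subV-subV h V)
    subC-subC h (cpair M N)  = cong₂ cpair (subC-subC h M) (subC-subC h N)
    subC-subC h (prj i M)    = cong (prj i) (subC-subC h M)
    subC-subC h (reflect M)  = cong reflect (subC-subC h M)
    subC-subC h (reify T M)  = cong₂ reify (subM-subM h T) (subC-subC h M)

    subB-subB : (∀ i → subV σ' (σ i) ≡ τ i) → ∀ bs → subB σ' (subB σ bs) ≡ subB τ bs
    subB-subB h []         = refl
    subB-subB h (_∷_ l M bs) = cong₂ (_∷_ l) (subC-subC (exts-subV h) M) (subB-subB h bs)

    subM-subM : (∀ i → subV σ' (σ i) ≡ τ i) → ∀ T → subM σ' (subM σ T) ≡ subM τ T
    subM-subM h (where' Nu Nb) =
      cong₂ where' (subC-subC (exts-subV h) Nu) (subC-subC (exts-subV (exts-subV h)) Nb)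

  exts-var : {σ : Sub n n} → (∀ i → σ i ≡ var i) → ∀ i → exts σ i ≡ var i
  exts-var h zero    = refl
  exts-var h (suc i) = cong (renV suc) (h i)

  mutual
    subV-id : {σ : Sub n n} → (∀ i → σ i ≡ var i) → ∀ V → subV σ V ≡ V
    subV-id h (var i)    = h i
    subV-id h unit       = refl
    subV-id h (pair V W) = cong₂ pair (subV-id h V) (subV-id h W)
    subV-id h (inj l V)  = cong (inj l) (subV-id h V)
    subV-id h (thunk M)  = cong thunk (subC-id h M)

    subC-id : {σ : Sub n n} → (∀ i → σ i ≡ var i) → ∀ M → subC σ M ≡ M
    subC-id h (split V M)  = cong₂ split (subV-id h V) (subC-id (exts-var (exts-var h)) M)
    subC-id h (case V bs)  = cong₂ case (subV-id h V) (subB-id h bs)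
    subC-id h (force V)    = cong force (subV-id h V)
    subC-id h (ret V)      = cong ret (subV-id h V)
    subC-id h (lett M N)   = cong₂ lett (subC-id h M) (subC-id (exts-var h) N)
    subC-id h (lam M)      = cong lam (subC-id (exts-var h) M)
    subC-id h (app M V)    = cong₂ app (subC-id h M) (subV-id h V)
    subC-id h (cpair M N)  = cong₂ cpair (subC-id h M) (subC-id h N)
    subC-id h (prj i M)    = cong (prj i) (subC-id h M)
    subC-id h (reflect M)  = cong reflect (subC-id h M)
    subC-id h (reify T M)  = cong₂ reify (subM-id h T) (subC-id h M)

    subB-id : {σ : Sub n n} → (∀ i → σ i ≡ var i) → ∀ bs → subB σ bs ≡ bs
    subB-id h []         = refl
    subB-id h (_∷_ l M bs) = cong₂ (_∷_ l) (subC-id (exts-var h) M) (subB-id h bs)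

    subM-id : {σ : Sub n n} → (∀ i → σ i ≡ var i) → ∀ T → subM σ T ≡ T
    subM-id h (where' Nu Nb) = cong₂ where' (subC-id (exts-var h) Nu) (subC-id (exts-var (exts-var h)) Nb)

  subV-renV-cancel : (∀ i → σ (ρ i) ≡ var i) → ∀ V → subV σ (renV ρ V) ≡ V
  subV-renV-cancel h V = trans (subV-renV h V) (subV-id (λ _ → refl) V)

  subC-renC-cancel : (∀ i → σ (ρ i) ≡ var i) → ∀ M → subC σ (renC ρ M) ≡ M
  subC-renC-cancel h M = trans (subC-renC h M) (subC-id (λ _ → refl) M)

  subC-sub1-exts : (V W : Val n) → ∀ M → subC (sub1 W) (subC (exts (sub1 V)) M) ≡ M [ V , W ]₂
  subC-sub1-exts V W = subC-subC λ where
    zero          → refl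
    (suc zero)    → subV-renV-cancel (λ _ → refl) V
    (suc (suc i)) → refl

open RefSubstitution

module ⇝⁺-Reasoning {n : ℕ} where
  open Ref using (Comp; _⇝_; _⇝⁺_)

  infix  1 begin_
  infixr 2 _⇝⁺⟨_⟩_ _⇝⟨_⟩_ _≡⟨_⟩_
  infix  3 _∎

  -- The index records whether the chain contains a reduction step.
  data Chain : Bool → Comp n → Comp n → Set where
    _∎      : ∀ M → Chain false M M
    _≡⟨_⟩_  : ∀ M {N P b} → M ≡ N → Chain b N P → Chain b M P
    _⇝⁺⟨_⟩_ : ∀ M {N P b} → M ⇝⁺ N → Chain b N P → Chain true M P

  _⇝⟨_⟩_ : ∀ M {N P b} → M ⇝ N → Chain b N P → Chain true M P
  M ⇝⟨ s ⟩ c = M ⇝⁺⟨ [ s ] ⟩ c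

  private
    extend : ∀ {M N P b} → M ⇝⁺ N → Chain b N P → M ⇝⁺ P
    extend r (_ ∎)            = r
    extend r (_ ≡⟨ refl ⟩ c)  = extend r c
    extend r (_ ⇝⁺⟨ r' ⟩ c)   = extend (r ++ r') c

  begin_ : ∀ {M N} → Chain true M N → M ⇝⁺ N
  begin (_ ≡⟨ refl ⟩ c) = begin c
  begin (_ ⇝⁺⟨ r ⟩ c)   = extend r c

module RefReduction where
  open Ref
  open ⇝⁺-Reasoning

  private
    variable
      n m : ℕ

  ⇝⁺-map : (f : Comp n → Comp m) → (∀ {M N} → M ⇝ N → f M ⇝ f N) →
           ∀ {M N} → M ⇝⁺ N → f M ⇝⁺ f N
  ⇝⁺-map f g [ s ]   = [ g s ]
  ⇝⁺-map f g (s ∷ r) = g s ∷ ⇝⁺-map f g r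

  app₁⁺ : ∀ {M M' : Comp n} V → M ⇝⁺ M' → app M V ⇝⁺ app M' V
  app₁⁺ V = ⇝⁺-map (λ M → app M V) app₁

  β-≡ : ∀ {M N P : Comp n} → M ⟶β N → N ≡ P → M ⇝⁺ P
  β-≡ s refl = [ β s ]

  lam²-β : ∀ (M : Comp (suc (suc n))) V W → app (app (lam (lam M)) V) W ⇝⁺ (M [ V , W ]₂)
  lam²-β M V W = begin
    app (app (lam (lam M)) V) W             ⇝⟨ app₁ (β (lam-β _ V)) ⟩
    app (lam (subC (exts (sub1 V)) M)) W    ⇝⟨ β (lam-β _ W) ⟩
    subC (sub1 W) (subC (exts (sub1 V)) M)  ≡⟨ subC-sub1-exts V W M ⟩
    M [ V , W ]₂                            ∎

  weakened-lam-var₀-β : ∀ (M : Comp (suc n)) →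
                        app (force (thunk (lam (renC (liftR suc) M)))) (var zero) ⇝⁺ M
  weakened-lam-var₀-β M = begin
    app (force (thunk (lam (renC (liftR suc) M)))) (var zero)  ⇝⟨ app₁ (β (force-β _)) ⟩
    app (lam (renC (liftR suc) M)) (var zero)                  ⇝⟨ β (lam-β _ _) ⟩
    subC (sub1 (var zero)) (renC (liftR suc) M)
      ≡⟨ subC-renC-cancel (λ { zero → refl ; (suc _) → refl }) M ⟩
    M                                                          ∎

  reify-Cont-ret : ∀ (V C : Val n) → app (reify Cont (ret V)) C ⇝⁺ app (force C) V
  reify-Cont-ret V C = begin
    app (reify Cont (ret V)) C                         ⇝⟨ app₁ (β (reify-ret Cont V)) ⟩
    app (lam (app (force (var zero)) (renV suc V))) C  ⇝⟨ β (lam-β _ C) ⟩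
    app (force C) (subV (sub1 C) (renV suc V))
      ≡⟨ cong (app (force C)) (subV-renV-cancel (λ _ → refl) V) ⟩
    app (force C) V                                    ∎

  reify-Cont-reflect : ∀ (𝓗 : Hoist n) N C →
    app (reify Cont (plugH 𝓗 (reflect N))) C ⇝⁺
    app N (thunk (lam (app (reify Cont (plugH (renHo suc 𝓗) (ret (var zero)))) (renV suc C))))
  reify-Cont-reflect {n} 𝓗 N C = begin
    app (reify Cont (plugH 𝓗 (reflect N))) C
      ⇝⟨ app₁ (β (reify-ref Cont 𝓗 N)) ⟩
    app (lam (app (force (thunk (renC suc N))) (resume (renV suc (renV suc F)) (var (suc zero))))) C
      ⇝⟨ β (lam-β _ C) ⟩
    app (force (thunk (subC (sub1 C) (renC suc N))))
        (resume (subV (exts (sub1 C)) (renV suc (renV suc F))) (renV suc C))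
      ≡⟨ cong₂ (λ X Y → app (force (thunk X)) (resume Y (renV suc C)))
               (subC-renC-cancel (λ _ → refl) N) F↑ ⟩
    app (force (thunk N)) (resume (renV suc F) (renV suc C))
      ⇝⟨ app₁ (β (force-β N)) ⟩
    app N (resume (renV suc F) (renV suc C))
      ⇝⁺⟨ ⇝⁺-map (λ X → app N (thunk (lam (app X (renV suc C)))))
                 (λ s → app₂ (thunk₁ (lam₁ (app₁ s))))
                 (weakened-lam-var₀-β R) ⟩
    app N (thunk (lam (app R (renV suc C))))
      ∎
    where
    R : Comp (suc n)
    R = reify Cont (plugH (renHo suc 𝓗) (ret (var zero)))
    F : Val n
    F = thunk (lam R)
    resume : ∀ {n} → Val (suc n) → Val (suc n) → Val n
    resume f c = thunk (lam (app (app (force f) (var zero)) c))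
    F↑ : subV (exts (sub1 C)) (renV suc (renV suc F)) ≡ renV suc F
    F↑ = trans (sym (renV-subV-comm (λ _ → refl) (renV suc F)))
               (cong (renV suc) (subV-renV-cancel (λ _ → refl) F))

open RefReduction

private
  variable
    n m : ℕ
    σ : E.Sub n m
    τ : R.Sub n m

-- (handle M with H)* is runCont M* (transRet H) (transOps H) by definition.
runCont : R.Comp n → R.Val n → R.Val n → R.Comp n
runCont M Kr Ko = R.app (R.app (R.reify R.Cont M) Kr) Ko

runCont-cong : ∀ {M M' : R.Comp n} {Kr Kr' Ko Ko'} → M ≡ M' → Kr ≡ Kr' → Ko ≡ Ko' →
               runCont M Kr Ko ≡ runCont M' Kr' Ko'
runCont-cong refl refl refl = refl

transRet : E.Handler n → R.Val n
transRet (E.handler Nret cs) = R.thunk (R.lam (R.lam (R.renC suc (transC Nret))))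

transOps : E.Handler n → R.Val n
transOps (E.handler Nret cs) = R.thunk (R.lam (R.case (R.var zero) (transO cs)))

-- h! (op (V, {λy. k! y h})) in scope k(1), h(0); (op V)* is reflect (λk.λh. opBody op (renV wk2 V*)).
opBody : Label → R.Val (suc (suc n)) → R.Comp (suc (suc n))
opBody o V =
  R.app (R.force (R.var zero))
        (R.inj o (R.pair V (R.thunk (R.lam (R.app (R.app (R.force (R.var (suc (suc zero)))) (R.var zero))
                                                  (R.var (suc zero)))))))

opBranch : E.Comp (suc (suc n)) → R.Comp (suc (suc n))
opBranch N = R.split (R.var zero) (R.renC (liftR (liftR wk2)) (transC N))

mutual
  transV-renV : (ρ : Ren n m) → ∀ V → transV (E.renV ρ V) ≡ R.renV ρ (transV V)
  transV-renV ρ (E.var i)    = refl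
  transV-renV ρ E.unit       = refl
  transV-renV ρ (E.pair V W) = cong₂ R.pair (transV-renV ρ V) (transV-renV ρ W)
  transV-renV ρ (E.inj l V)  = cong (R.inj l) (transV-renV ρ V)
  transV-renV ρ (E.thunk M)  = cong R.thunk (transC-renC ρ M)

  transC-renC : (ρ : Ren n m) → ∀ M → transC (E.renC ρ M) ≡ R.renC ρ (transC M)
  transC-renC ρ (E.split V M)  = cong₂ R.split (transV-renV ρ V) (transC-renC _ M)
  transC-renC ρ (E.case V bs)  = cong₂ R.case (transV-renV ρ V) (transB-renB ρ bs)
  transC-renC ρ (E.force V)    = cong R.force (transV-renV ρ V)
  transC-renC ρ (E.ret V)      = cong R.ret (transV-renV ρ V)
  transC-renC ρ (E.lett M N)   = cong₂ R.lett (transC-renC ρ M) (transC-renC _ N)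
  transC-renC ρ (E.lam M)      = cong R.lam (transC-renC _ M)
  transC-renC ρ (E.app M V)    = cong₂ R.app (transC-renC ρ M) (transV-renV ρ V)
  transC-renC ρ (E.cpair M N)  = cong₂ R.cpair (transC-renC ρ M) (transC-renC ρ N)
  transC-renC ρ (E.prj i M)    = cong (R.prj i) (transC-renC ρ M)
  transC-renC ρ (E.op o V)     =
    cong (λ X → R.reflect (R.lam (R.lam (opBody o X))))
         (trans (cong (R.renV wk2) (transV-renV ρ V)) (renV-renV-comm (λ _ → refl) (transV V)))
  transC-renC ρ (E.handle M H@(E.handler _ _)) =
    runCont-cong (transC-renC ρ M) (transRet-renH ρ H) (transOps-renH ρ H)

  transB-renB : (ρ : Ren n m) → ∀ bs → transB (E.renB ρ bs) ≡ R.renB ρ (transB bs)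
  transB-renB ρ E.[]             = refl
  transB-renB ρ (E._∷_ l M bs)   = cong₂ (R._∷_ l) (transC-renC _ M) (transB-renB ρ bs)

  transO-renO : (ρ : Ren n m) → ∀ cs → transO (E.renO ρ cs) ≡ R.renB (liftR ρ) (transO cs)
  transO-renO ρ E.[]             = refl
  transO-renO ρ (E.claus o N cs) =
    cong₂ (λ X → R._∷_ o (R.split (R.var zero) X))
          (trans (cong (R.renC (liftR (liftR wk2))) (transC-renC _ N))
                 (renC-renC-comm (λ { zero → refl ; (suc zero) → refl ; (suc (suc _)) → refl })
                                 (transC N)))
          (transO-renO ρ cs)

  transRet-renH : (ρ : Ren n m) → ∀ H → transRet (E.renH ρ H) ≡ R.renV ρ (transRet H)
  transRet-renH ρ (E.handler Nret cs) =
    cong (λ X → R.thunk (R.lam (R.lam X)))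
         (trans (cong (R.renC suc) (transC-renC _ Nret)) (renC-renC-comm (λ _ → refl) (transC Nret)))

  transOps-renH : (ρ : Ren n m) → ∀ H → transOps (E.renH ρ H) ≡ R.renV ρ (transOps H)
  transOps-renH ρ (E.handler Nret cs) =
    cong (λ X → R.thunk (R.lam (R.case (R.var zero) X))) (transO-renO ρ cs)

exts-transV : (∀ i → transV (σ i) ≡ τ i) →
              ∀ i → transV (E.exts σ i) ≡ R.exts τ i
exts-transV h zero = refl
exts-transV {σ = σ} h (suc i) = trans (transV-renV suc (σ i)) (cong (R.renV suc) (h i))

mutual
  transV-subV : (∀ i → transV (σ i) ≡ τ i) →
                ∀ V → transV (E.subV σ V) ≡ R.subV τ (transV V)
  transV-subV h (E.var i)    = h i
  transV-subV h E.unit       = refl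
  transV-subV h (E.pair V W) = cong₂ R.pair (transV-subV h V) (transV-subV h W)
  transV-subV h (E.inj l V)  = cong (R.inj l) (transV-subV h V)
  transV-subV h (E.thunk M)  = cong R.thunk (transC-subC h M)

  transC-subC : (∀ i → transV (σ i) ≡ τ i) →
                ∀ M → transC (E.subC σ M) ≡ R.subC τ (transC M)
  transC-subC h (E.split V M)  = cong₂ R.split (transV-subV h V) (transC-subC (exts-transV (exts-transV h)) M)
  transC-subC h (E.case V bs)  = cong₂ R.case (transV-subV h V) (transB-subB h bs)
  transC-subC h (E.force V)    = cong R.force (transV-subV h V)
  transC-subC h (E.ret V)      = cong R.ret (transV-subV h V)
  transC-subC h (E.lett M N)   = cong₂ R.lett (transC-subC h M) (transC-subC (exts-transV h) N)
  transC-subC h (E.lam M)      = cong R.lam (transC-subC (exts-transV h) M)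
  transC-subC h (E.app M V)    = cong₂ R.app (transC-subC h M) (transV-subV h V)
  transC-subC h (E.cpair M N)  = cong₂ R.cpair (transC-subC h M) (transC-subC h N)
  transC-subC h (E.prj i M)    = cong (R.prj i) (transC-subC h M)
  transC-subC {τ = τ} h (E.op o V) =
    cong (λ X → R.reflect (R.lam (R.lam (opBody o X))))
         (trans (cong (R.renV wk2) (transV-subV h V)) (renV-subV-comm (wk2-exts² τ) (transV V)))
  transC-subC h (E.handle M H@(E.handler _ _)) =
    runCont-cong (transC-subC h M) (transRet-subH h H) (transOps-subH h H)

  transB-subB : (∀ i → transV (σ i) ≡ τ i) →
                ∀ bs → transB (E.subB σ bs) ≡ R.subB τ (transB bs)
  transB-subB h E.[]           = refl
  transB-subB h (E._∷_ l M bs) = cong₂ (R._∷_ l) (transC-subC (exts-transV h) M) (transB-subB h bs)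

  transO-subO : (∀ i → transV (σ i) ≡ τ i) →
                ∀ cs → transO (E.subO σ cs) ≡ R.subB (R.exts τ) (transO cs)
  transO-subO h E.[]             = refl
  transO-subO {τ = τ} h (E.claus o N cs) =
    cong₂ (λ X → R._∷_ o (R.split (R.var zero) X))
          (trans (cong (R.renC (liftR (liftR wk2))) (transC-subC (exts-transV (exts-transV h)) N))
                 (renC-subC-comm (exts-comm (exts-comm (wk2-exts² τ))) (transC N)))
          (transO-subO h cs)

  transRet-subH : (∀ i → transV (σ i) ≡ τ i) →
                  ∀ H → transRet (E.subH σ H) ≡ R.subV τ (transRet H)
  transRet-subH h (E.handler Nret cs) =
    cong (λ X → R.thunk (R.lam (R.lam X)))
         (trans (cong (R.renC suc) (transC-subC (exts-transV h) Nret))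
                (renC-subC-comm (λ _ → refl) (transC Nret)))

  transOps-subH : (∀ i → transV (σ i) ≡ τ i) →
                  ∀ H → transOps (E.subH σ H) ≡ R.subV τ (transOps H)
  transOps-subH h (E.handler Nret cs) =
    cong (λ X → R.thunk (R.lam (R.case (R.var zero) X))) (transO-subO h cs)

transC-[]₁ : ∀ (M : E.Comp (suc n)) V → transC (M E.[ V ]₁) ≡ transC M R.[ transV V ]₁
transC-[]₁ M V = transC-subC (λ { zero → refl ; (suc _) → refl }) M

transC-[]₂ : ∀ (M : E.Comp (suc (suc n))) V W →
             transC (M E.[ V , W ]₂) ≡ transC M R.[ transV V , transV W ]₂
transC-[]₂ M V W = transC-subC (λ { zero → refl ; (suc zero) → refl ; (suc (suc _)) → refl }) M

transC-pick : ∀ i (M₁ M₂ : E.Comp n) →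
              transC (E.pick i M₁ M₂) ≡ R.pick i (transC M₁) (transC M₂)
transC-pick i₁ M₁ M₂ = refl
transC-pick i₂ M₁ M₂ = refl

lookupB-transB : ∀ (bs : E.Branches n) l → R.lookupB (transB bs) l ≡ Maybe.map transC (E.lookupB bs l)
lookupB-transB E.[]            l = refl
lookupB-transB (E._∷_ l' M bs) l with l ≡ᵇ l'
... | true  = refl
... | false = lookupB-transB bs l

lookupB-transO : ∀ (cs : E.OpClauses n) o → R.lookupB (transO cs) o ≡ Maybe.map opBranch (E.lookupO cs o)
lookupB-transO E.[]              o = refl
lookupB-transO (E.claus o' N cs) o with o ≡ᵇ o'
... | true  = refl
... | false = lookupB-transO cs o

lookupB-subB : ∀ (σ : R.Sub n m) bs l →
               R.lookupB (R.subB σ bs) l ≡ Maybe.map (R.subC (R.exts σ)) (R.lookupB bs l)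
lookupB-subB σ R.[]            l = refl
lookupB-subB σ (R._∷_ l' M bs) l with l ≡ᵇ l'
... | true  = refl
... | false = lookupB-subB σ bs l

transBF : E.BFrame n → R.BFrame n
transBF (E.letF N) = R.letF (transC N)
transBF (E.appF V) = R.appF (transV V)
transBF (E.prjF i) = R.prjF i

transHo : E.Hoist n → R.Hoist n
transHo []      = []
transHo (B ∷ 𝓗) = transBF B ∷ transHo 𝓗

transC-plugH : ∀ (𝓗 : E.Hoist n) M → transC (E.plugH 𝓗 M) ≡ R.plugH (transHo 𝓗) (transC M)
transC-plugH []             M = refl
transC-plugH (E.letF N ∷ 𝓗) M = cong (λ X → R.lett X (transC N)) (transC-plugH 𝓗 M)
transC-plugH (E.appF V ∷ 𝓗) M = cong (λ X → R.app X (transV V)) (transC-plugH 𝓗 M)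
transC-plugH (E.prjF i ∷ 𝓗) M = cong (R.prj i) (transC-plugH 𝓗 M)

transHo-renHo : (ρ : Ren n m) → ∀ 𝓗 → transHo (E.renHo ρ 𝓗) ≡ R.renHo ρ (transHo 𝓗)
transHo-renHo ρ []             = refl
transHo-renHo ρ (E.letF N ∷ 𝓗) = cong₂ _∷_ (cong R.letF (transC-renC _ N)) (transHo-renHo ρ 𝓗)
transHo-renHo ρ (E.appF V ∷ 𝓗) = cong₂ _∷_ (cong R.appF (transV-renV ρ V)) (transHo-renHo ρ 𝓗)
transHo-renHo ρ (E.prjF i ∷ 𝓗) = cong (R.prjF i ∷_) (transHo-renHo ρ 𝓗)

resumption : E.Hoist n → E.Handler n → E.Val n
resumption 𝓗 H = E.thunk (E.lam (E.handle (E.plugH (E.renHo suc 𝓗) (E.ret (E.var zero))) (E.renH suc H)))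

transV-resumption : ∀ (𝓗 : E.Hoist n) H →
  transV (resumption 𝓗 H) ≡
  R.thunk (R.lam (runCont (R.plugH (R.renHo suc (transHo 𝓗)) (R.ret (R.var zero)))
                          (R.renV suc (transRet H)) (R.renV suc (transOps H))))
transV-resumption 𝓗 H@(E.handler _ _) =
  cong (λ X → R.thunk (R.lam X))
       (runCont-cong (trans (transC-plugH (E.renHo suc 𝓗) _)
                            (cong (λ 𝓚 → R.plugH 𝓚 (R.ret (R.var zero))) (transHo-renHo suc 𝓗)))
                     (transRet-renH suc H) (transOps-renH suc H))

module Simulation where
  open Ref
  open ⇝⁺-Reasoning

  handle-ret⇝⁺ : ∀ (V : E.Val n) H →
                 transC (E.handle (E.ret V) H) ⇝⁺ transC (E.retClause H E.[ V ]₁)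
  handle-ret⇝⁺ {n} V H@(E.handler Nret cs) = begin
    runCont (ret V*) Kr Ko                      ⇝⁺⟨ app₁⁺ Ko (reify-Cont-ret V* Kr) ⟩
    app (app (force Kr) V*) Ko                  ⇝⟨ app₁ (app₁ (β (force-β _))) ⟩
    app (app (lam (lam (renC suc Nr*))) V*) Ko  ⇝⁺⟨ lam²-β _ V* Ko ⟩
    renC suc Nr* [ V* , Ko ]₂                   ≡⟨ subC-renC (λ { zero → refl ; (suc _) → refl }) Nr* ⟩
    Nr* [ V* ]₁                                 ≡⟨ sym (transC-[]₁ Nret V) ⟩
    transC (Nret E.[ V ]₁)                      ∎
    where
    V* Kr Ko : Val n
    V*  = transV V
    Kr  = transRet H
    Ko  = transOps H
    Nr* : Comp (suc n)
    Nr* = transC Nret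

  handle-op⇝⁺ : ∀ (𝓗 : E.Hoist n) o V H →
    transC (E.handle (E.plugH 𝓗 (E.op o V)) H) ⇝⁺
    app (force (transOps H)) (inj o (pair (transV V) (transV (resumption 𝓗 H))))
  handle-op⇝⁺ {n} 𝓗 o V H@(E.handler _ _) = begin
    transC (E.handle (E.plugH 𝓗 (E.op o V)) H)
      ≡⟨ cong (λ X → runCont X Kr Ko) (transC-plugH 𝓗 (E.op o V)) ⟩
    runCont (plugH (transHo 𝓗) (reflect Op)) Kr Ko
      ⇝⁺⟨ app₁⁺ Ko (reify-Cont-reflect (transHo 𝓗) Op Kr) ⟩
    app (app Op Kk) Ko
      ⇝⁺⟨ lam²-β _ Kk Ko ⟩
    app (force Ko) (inj o (pair (subV (sub2 Kk Ko) (renV wk2 V*)) (resume Kk·y)))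
      ≡⟨ cong (λ X → app (force Ko) (inj o (pair X (resume Kk·y))))
              (subV-renV-cancel (λ _ → refl) V*) ⟩
    app (force Ko) (inj o (pair V* (resume Kk·y)))
      ⇝⁺⟨ ⇝⁺-map (λ X → app (force Ko) (inj o (pair V* (resume X))))
                 (λ s → app₂ (inj₁ (pair₂ (thunk₁ (lam₁ (app₁ s))))))
                 (weakened-lam-var₀-β _) ⟩
    app (force Ko) (inj o (pair V* (resume (app Rk (renV suc Kr)))))
      ≡⟨ cong (λ X → app (force Ko) (inj o (pair V* X))) (sym (transV-resumption 𝓗 H)) ⟩
    app (force Ko) (inj o (pair V* (transV (resumption 𝓗 H))))
      ∎
    where
    V* Kr Ko Kk : Val n
    V* = transV V
    Kr = transRet H
    Ko = transOps H
    Op : Comp n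
    Op = lam (lam (opBody o (renV wk2 V*)))
    Rk : Comp (suc n)
    Rk = reify Cont (plugH (renHo suc (transHo 𝓗)) (ret (var zero)))
    Kk = thunk (lam (app Rk (renV suc Kr)))
    Kk·y : Comp (suc n)
    Kk·y = app (force (renV suc Kk)) (var zero)
    resume : Comp (suc n) → Val n
    resume X = thunk (lam (app X (renV suc Ko)))

  transOps-dispatch : ∀ Nret cs o N (V W : Val n) → E.lookupO cs o ≡ just N →
    app (force (transOps (E.handler Nret cs))) (inj o (pair V W)) ⇝⁺ (transC N [ V , W ]₂)
  transOps-dispatch {n} Nret cs o N V W eq = begin
    app (force (thunk (lam (case (var zero) cs*)))) P  ⇝⟨ app₁ (β (force-β _)) ⟩
    app (lam (case (var zero) cs*)) P                  ⇝⟨ β (lam-β _ P) ⟩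
    case P (subB (sub1 P) cs*)                         ⇝⟨ β (case-β o (pair V W) _ _ lookup) ⟩
    split (pair V W) (subC σ₂ (subC σ₁ N↑))            ⇝⟨ β (split-β V W _) ⟩
    subC (sub2 V W) (subC σ₂ (subC σ₁ N↑))
      ≡⟨ trans (subC-subC (λ _ → refl) _)
               (trans (subC-subC (λ _ → refl) N↑)
                      (subC-renC (λ { zero → refl ; (suc zero) → refl ; (suc (suc _)) → refl })
                                 (transC N))) ⟩
    transC N [ V , W ]₂                                ∎
    where
    cs* : Branches (suc n)
    cs* = transO cs
    P : Val n
    P = inj o (pair V W)
    N↑ : Comp (suc (suc (suc (suc n))))
    N↑ = renC (liftR (liftR wk2)) (transC N)
    σ₁ : Sub (suc (suc (suc (suc n)))) (suc (suc (suc n)))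
    σ₁ = exts (exts (exts (sub1 P)))
    σ₂ : Sub (suc (suc (suc n))) (suc (suc n))
    σ₂ = exts (exts (sub1 (pair V W)))
    lookup : lookupB (subB (sub1 P) cs*) o ≡ just (subC (exts (sub1 P)) (opBranch N))
    lookup = trans (lookupB-subB (sub1 P) cs* o)
                   (cong (Maybe.map (subC (exts (sub1 P))))
                         (trans (lookupB-transO cs o) (cong (Maybe.map opBranch) eq)))

  transC-⟶β : ∀ {M N : E.Comp n} → M E.⟶β N → transC M ⇝⁺ transC N
  transC-⟶β (E.split-β V₁ V₂ M)     = β-≡ (split-β _ _ _) (sym (transC-[]₂ M V₁ V₂))
  transC-⟶β (E.case-β l V bs M eq)  =
    β-≡ (case-β l _ _ _ (trans (lookupB-transB bs l) (cong (Maybe.map transC) eq))) (sym (transC-[]₁ M V))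
  transC-⟶β (E.force-β M)           = β-≡ (force-β _) refl
  transC-⟶β (E.let-β V N)           = β-≡ (let-β _ _) (sym (transC-[]₁ N V))
  transC-⟶β (E.lam-β M V)           = β-≡ (lam-β _ _) (sym (transC-[]₁ M V))
  transC-⟶β (E.prj-β i M₁ M₂)       = β-≡ (prj-β i _ _) (sym (transC-pick i M₁ M₂))
  transC-⟶β (E.ret-β V H)           = handle-ret⇝⁺ V H
  transC-⟶β (E.op-β 𝓗 o V H@(E.handler Nret cs) N eq) = begin
    transC (E.handle (E.plugH 𝓗 (E.op o V)) H)
      ⇝⁺⟨ handle-op⇝⁺ 𝓗 o V H ⟩
    app (force (transOps H)) (inj o (pair (transV V) (transV (resumption 𝓗 H))))
      ⇝⁺⟨ transOps-dispatch Nret cs o N _ _ eq ⟩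
    transC N [ transV V , transV (resumption 𝓗 H) ]₂
      ≡⟨ sym (transC-[]₂ N V (resumption 𝓗 H)) ⟩
    transC (N E.[ V , resumption 𝓗 H ]₂)
      ∎

  transC-plug⇝⁺ : ∀ (K : E.ECtx n) {M N} → transC M ⇝⁺ transC N →
                  transC (E.plug K M) ⇝⁺ transC (E.plug K N)
  transC-plug⇝⁺ []                              r = r
  transC-plug⇝⁺ (E.basic (E.letF _) ∷ K)        r = ⇝⁺-map _ lett₁ (transC-plug⇝⁺ K r)
  transC-plug⇝⁺ (E.basic (E.appF _) ∷ K)        r = ⇝⁺-map _ app₁ (transC-plug⇝⁺ K r)
  transC-plug⇝⁺ (E.basic (E.prjF _) ∷ K)        r = ⇝⁺-map _ prj₁ (transC-plug⇝⁺ K r)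
  transC-plug⇝⁺ (E.handleF (E.handler _ _) ∷ K) r =
    ⇝⁺-map _ (λ s → app₁ (app₁ (reify₂ s))) (transC-plug⇝⁺ K r)

open Simulation

theorem6p9 : ∀ {n} {M N : Eff.Comp n} → M Eff.⟶ N → transC M Ref.⇝⁺ transC N
theorem6p9 (Eff.ctx K s) = transC-plug⇝⁺ K (transC-⟶β s)
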